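{- Let $\mathcal T$ be a finite tree whose vertex set is bipartitioned into $X$ and $Y$ (every edge joins a vertex of $X$ to a vertex of $Y$), with $\mathrm{Card}(X),\mathrm{Card}(Y)\ge 2$, and let $E$ be its set of edges, written as pairs $(x,y)$ with $x\in X$, $y\in Y$. For $x\in X$, $y\in Y$ set $Y_x=\{y\in Y:(x,y)\in E\}$ and $X_y=\{x\in X:(x,y)\in E\}$. Let $(G,+)$ be an abelian group and $H$ a subgroup of $G$. Suppose there is a function $g:X\cup Y\cup E\to G$ such that (1) $g(X\cup Y)\subseteq H$, and (2) for all $x\in X$, $g(x)=\sum_{y\in Y_x}g(x,y)$, and for all $y\in Y$, $g(y)=\sum_{x\in X_y}g(x,y)$. Then $g(x,y)\in H$ for all $(x,y)\in E$. -}

module Defs where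

open import Level using (Level; _⊔_; suc)
open import Data.Nat using (ℕ; _≤_)
open import Data.Fin using (Fin) renaming (suc to fsuc; zero to fzero)
open import Data.Fin using (inject₁; fromℕ)
open import Data.Bool using (Bool; true; false; if_then_else_)
open import Data.Sum using (_⊎_; inj₁; inj₂)
open import Data.Product using (Σ; _×_; ∃)
open import Data.Empty using (⊥)
open import Relation.Nullary using (¬_)
open import Relation.Binary.PropositionalEquality using (_≡_)
open import Relation.Binary.Construct.Closure.ReflexiveTransitive using (Star)
open import Function.Definitions using (Injective)
open import Algebra.Bundles using (AbelianGroup)
open import Algebra.Definitions.RawMonoid using (sum)

-- A finite bipartite simple graph with parts X = Fin m, Y = Fin n;
-- the edge set E ⊆ X × Y is given by its (decidable) indicator.
BipGraph : ℕ → ℕ → Set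
BipGraph m n = Fin m → Fin n → Bool

IsEdge : ∀ {m n} → BipGraph m n → Fin m → Fin n → Set
IsEdge E x y = E x y ≡ true

Vertex : ℕ → ℕ → Set
Vertex m n = Fin m ⊎ Fin n

Adj : ∀ {m n} → BipGraph m n → Vertex m n → Vertex m n → Set
Adj E (inj₁ x) (inj₁ x') = ⊥
Adj E (inj₁ x) (inj₂ y)  = IsEdge E x y
Adj E (inj₂ y) (inj₁ x)  = IsEdge E x y
Adj E (inj₂ y) (inj₂ y') = ⊥

Connected : ∀ {m n} → BipGraph m n → Set
Connected {m} {n} E = (u v : Vertex m n) → Star (Adj E) u v

-- A cycle of length 2k (k ≥ 2) in a bipartite simple graph:
-- x₀ y₀ x₁ y₁ … x_{k-1} y_{k-1} x₀ with distinct xᵢ and distinct yᵢ,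
-- edges (xᵢ,yᵢ), (x_{i+1},yᵢ) and (x₀,y_{k-1}).  Here k = 2 + j.
record Cycle {m n : ℕ} (E : BipGraph m n) (j : ℕ) : Set where
  field
    xs     : Fin (ℕ.suc (ℕ.suc j)) → Fin m
    ys     : Fin (ℕ.suc (ℕ.suc j)) → Fin n
    xs-inj : Injective _≡_ _≡_ xs
    ys-inj : Injective _≡_ _≡_ ys
    edge₁  : ∀ i → IsEdge E (xs i) (ys i)
    edge₂  : ∀ (i : Fin (ℕ.suc j)) → IsEdge E (xs (fsuc i)) (ys (inject₁ i))
    close  : IsEdge E (xs fzero) (ys (fromℕ (ℕ.suc j)))

Acyclic : ∀ {m n} → BipGraph m n → Set
Acyclic E = ∀ j → ¬ Cycle E j

IsTree : ∀ {m n} → BipGraph m n → Set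
IsTree E = Connected E × Acyclic E

record IsSubgroup {c ℓ p : Level} (G : AbelianGroup c ℓ)
                  (H : AbelianGroup.Carrier G → Set p) : Set (c ⊔ ℓ ⊔ p) where
  open AbelianGroup G
  field
    resp   : ∀ {a b} → a ≈ b → H a → H b
    has-ε  : H ε
    closed : ∀ {a b} → H a → H b → H (a ∙ b)
    inv    : ∀ {a} → H a → H (a ⁻¹)

module _ {c ℓ : Level} (G : AbelianGroup c ℓ) where
  open AbelianGroup G

  sumYx : ∀ {m n} → BipGraph m n → (Fin m → Fin n → Carrier) → Fin m → Carrier
  sumYx E gE x = sum rawMonoid (λ y → if E x y then gE x y else ε)

  sumXy : ∀ {m n} → BipGraph m n → (Fin m → Fin n → Carrier) → Fin n → Carrier
  sumXy E gE y = sum rawMonoid (λ x → if E x y then gE x y else ε)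

module Submission where

-- Fix an edge (x₀,y₀) of the tree.  Deleting it disconnects the tree; let S
-- be the side containing x₀.  Then (x₀,y₀) is the only edge joining S to its
-- complement, and it leaves S through its X-endpoint.  Summing the vertex
-- conditions over the X-vertices of S counts every edge at such a vertex;
-- summing over the Y-vertices of S counts the same edges except (x₀,y₀), so
--   Σ_{x ∈ S∩X} g(x)  =  Σ_{y ∈ S∩Y} g(y) + g(x₀,y₀),
-- and g(x₀,y₀) is a difference of two elements of H.

open import Defs
open import Level using (Level)
open import Data.Nat using (ℕ; _≤_; z≤n; s≤s)
open import Data.Nat.Properties using (≤-trans)
open import Data.Fin using (Fin; zero; suc; inject₁; fromℕ)
import Data.Fin.Properties as Fin
open import Data.Bool using (Bool; true; false; if_then_else_; not; _∧_)
open import Data.Sum using (_⊎_; inj₁; inj₂)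
open import Data.Sum.Properties using (≡-dec; inj₂-injective)
open import Data.Product using (Σ; ∃; _×_; _,_; proj₁; proj₂)
open import Data.Empty using (⊥; ⊥-elim)
open import Function using (_$_; _∘′_)
open import Relation.Nullary using (¬_; Dec; yes; no; does)
open import Relation.Nullary.Decidable using (dec-true; dec-false)
open import Relation.Binary using (Rel; DecidableEquality)
open import Relation.Binary.PropositionalEquality using (_≡_; _≢_; refl; sym; trans; cong; subst)
open import Relation.Binary.Construct.Closure.ReflexiveTransitive using (Star; _◅_) renaming (ε to stay)
open import Data.List using (List; []; _∷_; _++_; length; lookup)
open import Data.List.Properties using (++-assoc; length-++-≤ʳ; ∷-injectiveˡ; ∷-injectiveʳ)
open import Data.List.Relation.Unary.All using ([]; _∷_)
open import Data.List.Relation.Unary.All.Properties using (¬Any⇒All¬)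
open import Data.List.Relation.Unary.Any using (here; there)
open import Data.List.Relation.Unary.AllPairs using ([]; _∷_)
open import Data.List.Relation.Unary.Linked as Linked using (Linked; []; [-]; _∷_)
open import Data.List.Relation.Unary.Unique.Propositional using (Unique)
open import Data.List.Relation.Unary.Unique.Propositional.Properties using (++⁺; Unique[x∷xs]⇒x∉xs)
open import Data.List.Relation.Binary.Disjoint.Propositional using (Disjoint)
open import Data.List.Relation.Binary.Subset.Propositional using (_⊆_)
open import Data.List.Membership.Propositional using (_∈_; _∉_)
open import Data.List.Membership.Propositional.Properties using (∈-∃++; ∈-++⁺ˡ; ∈-++⁺ʳ)
open import Algebra.Bundles using (AbelianGroup)

decided-yes : ∀ {p} {P : Set p} (P? : Dec P) → does P? ≡ true → P
decided-yes (yes p) _  = p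
decided-yes (no _)  ()

decided-no : ∀ {p} {P : Set p} (P? : Dec P) → does P? ≡ false → ¬ P
decided-no (yes _)  ()
decided-no (no ¬p) _ = ¬p

module ListFacts {a : Level} {A : Set a} where

  unique-∷ : ∀ {x : A} {xs} → x ∉ xs → Unique xs → Unique (x ∷ xs)
  unique-∷ x∉xs u = ¬Any⇒All¬ _ x∉xs ∷ u

  unique-prefix : ∀ (xs : List A) {ys} → Unique (xs ++ ys) → Unique xs
  unique-prefix []       _        = []
  unique-prefix (x ∷ xs) (x∉ ∷ u) =
    unique-∷ (λ x∈xs → Unique[x∷xs]⇒x∉xs (x∉ ∷ u) (∈-++⁺ˡ x∈xs)) (unique-prefix xs u)

  unique-++-∉ : ∀ (xs : List A) {a ys} → Unique (xs ++ a ∷ ys) → a ∉ xs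
  unique-++-∉ (x ∷ xs) u       (here refl) = Unique[x∷xs]⇒x∉xs u (∈-++⁺ʳ xs (here refl))
  unique-++-∉ (x ∷ xs) (_ ∷ u) (there a∈)  = unique-++-∉ xs u a∈

  rotate-unique : ∀ {v w : A} l → Unique (v ∷ w ∷ l) → Unique (w ∷ l ++ v ∷ [])
  rotate-unique l (v∉ ∷ u) =
    ++⁺ u ([] ∷ []) λ { (v∈ , here refl) → Unique[x∷xs]⇒x∉xs (v∉ ∷ u) v∈ }

  module _ {ℓ : Level} {R : Rel A ℓ} where

    linked-prefix : ∀ xs {v ys} → Linked R (xs ++ v ∷ ys) → Linked R (xs ++ v ∷ [])
    linked-prefix []           _       = [-]
    linked-prefix (x ∷ [])     (r ∷ _) = r ∷ [-]
    linked-prefix (x ∷ y ∷ xs) (r ∷ L) = r ∷ linked-prefix (y ∷ xs) L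

    linked-join : ∀ xs {v ys} → Linked R (xs ++ v ∷ []) → Linked R (v ∷ ys) → Linked R (xs ++ v ∷ ys)
    linked-join []           _        L₂ = L₂
    linked-join (x ∷ [])     (r ∷ _)  L₂ = r ∷ L₂
    linked-join (x ∷ y ∷ xs) (r ∷ L₁) L₂ = r ∷ linked-join (y ∷ xs) L₁ L₂

    rotate-linked : ∀ {v w : A} l → Linked R (v ∷ w ∷ l ++ v ∷ []) →
                    Linked R (w ∷ (l ++ v ∷ []) ++ w ∷ [])
    rotate-linked {v} {w} l L =
      subst (λ zs → Linked R (w ∷ zs)) (sym (++-assoc l (v ∷ []) (w ∷ [])))
            (linked-join (w ∷ l) (Linked.tail L) (Linked.head L ∷ [-]))

open ListFacts

module Walks {m n : ℕ} (E : BipGraph m n) where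

  V : Set
  V = Vertex m n

  _≟_ : DecidableEquality V
  _≟_ = ≡-dec Fin._≟_ Fin._≟_

  open import Data.List.Membership.DecPropositional _≟_ using (_∈?_)

  A : Rel V _
  A = Adj E

  A-sym : ∀ {u v} → A u v → A v u
  A-sym {inj₁ _} {inj₂ _} e = e
  A-sym {inj₂ _} {inj₁ _} e = e

  A-irrefl : ∀ {u v} → A u v → u ≢ v
  A-irrefl {inj₁ _} {inj₂ _} _ ()
  A-irrefl {inj₂ _} {inj₁ _} _ ()

  Walk : V → V → Set
  Walk = Star A

  verts  : ∀ {u t} → Walk u t → List V
  visits : ∀ {u t} → Walk u t → List V
  verts {u} w    = u ∷ visits w
  visits stay    = []
  visits (_ ◅ w) = verts w

  Simple : ∀ {u t} → Walk u t → Set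
  Simple w = Unique (verts w)

  last∈ : ∀ {u t} (w : Walk u t) → t ∈ verts w
  last∈ stay    = here refl
  last∈ (_ ◅ w) = there (last∈ w)

  verts-linked : ∀ {u t} (w : Walk u t) → Linked A (verts w)
  verts-linked stay    = [-]
  verts-linked (e ◅ w) = e ∷ verts-linked w

  suffix : ∀ {u v t} (w : Walk v t) → u ∈ verts w → Walk u t
  suffix w       (here refl) = w
  suffix (_ ◅ w) (there u∈w) = suffix w u∈w

  suffix-⊆ : ∀ {u v t} (w : Walk v t) (u∈w : u ∈ verts w) → verts (suffix w u∈w) ⊆ verts w
  suffix-⊆ w       (here refl) z∈ = z∈
  suffix-⊆ (_ ◅ w) (there u∈w) z∈ = there (suffix-⊆ w u∈w z∈)

  suffix-simple : ∀ {u v t} (w : Walk v t) (u∈w : u ∈ verts w) → Simple w → Simple (suffix w u∈w)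
  suffix-simple w       (here refl) s       = s
  suffix-simple (_ ◅ w) (there u∈w) (_ ∷ s) = suffix-simple w u∈w s

  loop-erase : ∀ {u t} → Walk u t → Σ (Walk u t) Simple
  loop-erase stay = stay , [] ∷ []
  loop-erase {u} (e ◅ s) with loop-erase s
  ... | w , sw with u ∈? verts w
  ...   | yes u∈w = suffix w u∈w , suffix-simple w u∈w sw
  ...   | no  u∉w = e ◅ w , unique-∷ u∉w sw

  data Interleaving : List V → List (Fin m × Fin n) → Set where
    []   : Interleaving [] []
    next : ∀ {x y vs ps} → Interleaving vs ps → Interleaving (inj₁ x ∷ inj₂ y ∷ vs) ((x , y) ∷ ps)

  interleave : ∀ {z} x l → Linked A (inj₁ x ∷ l ++ inj₁ z ∷ []) → ∃ (Interleaving (inj₁ x ∷ l))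
  interleave x []                     (() ∷ _)
  interleave x (inj₁ _ ∷ _)           (() ∷ _)
  interleave x (inj₂ y ∷ [])          _           = _ , next []
  interleave x (inj₂ y ∷ inj₂ _ ∷ _)  (_ ∷ () ∷ _)
  interleave x (inj₂ y ∷ inj₁ x′ ∷ l) (_ ∷ _ ∷ L) with interleave x′ l L
  ... | _ , I = _ , next I

  endpoint : Bool → Fin m × Fin n → V
  endpoint true  (x , _) = inj₁ x
  endpoint false (_ , y) = inj₂ y

  endpoint-∈ : ∀ s {vs ps} → Interleaving vs ps → ∀ i → endpoint s (lookup ps i) ∈ vs
  endpoint-∈ true  (next I) zero    = here refl
  endpoint-∈ false (next I) zero    = there (here refl)
  endpoint-∈ s     (next I) (suc i) = there (there (endpoint-∈ s I i))

  endpoint-injective : ∀ s {vs ps} → Interleaving vs ps → Unique vs →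
                       ∀ i j → endpoint s (lookup ps i) ≡ endpoint s (lookup ps j) → i ≡ j
  endpoint-injective s (next I) u zero    zero    _  = refl
  endpoint-injective s (next I) u zero    (suc j) eq =
    ⊥-elim (first-not-later s u (subst (_∈ _) (sym eq) (endpoint-∈ s I j)))
    where
    first-not-later : ∀ s {x y vs} → Unique (inj₁ x ∷ inj₂ y ∷ vs) → endpoint s (x , y) ∉ vs
    first-not-later true  u       v∈ = Unique[x∷xs]⇒x∉xs u (there v∈)
    first-not-later false (_ ∷ u) v∈ = Unique[x∷xs]⇒x∉xs u v∈
  endpoint-injective s (next I) u           (suc i) zero    eq =
    sym (endpoint-injective s (next I) u zero (suc i) (sym eq))
  endpoint-injective s (next I) (_ ∷ _ ∷ u) (suc i) (suc j) eq = cong suc (endpoint-injective s I u i j eq)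

  module _ {z : Fin m} where

    edges-along : ∀ {vs ps} → Interleaving vs ps → Linked A (vs ++ inj₁ z ∷ []) →
                  ∀ i → IsEdge E (proj₁ (lookup ps i)) (proj₂ (lookup ps i))
    edges-along (next I) (e ∷ _) zero    = e
    edges-along (next I) L       (suc i) = edges-along I (Linked.tail (Linked.tail L)) i

    edges-back : ∀ {vs p ps} → Interleaving vs (p ∷ ps) → Linked A (vs ++ inj₁ z ∷ []) →
                 ∀ (i : Fin (length ps)) →
                 IsEdge E (proj₁ (lookup (p ∷ ps) (suc i))) (proj₂ (lookup (p ∷ ps) (inject₁ i)))
    edges-back (next (next I)) (_ ∷ e ∷ _) zero    = e
    edges-back (next (next I)) L           (suc i) = edges-back (next I) (Linked.tail (Linked.tail L)) i

    edge-closing : ∀ {vs p ps} → Interleaving vs (p ∷ ps) → Linked A (vs ++ inj₁ z ∷ []) →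
                   IsEdge E z (proj₂ (lookup (p ∷ ps) (fromℕ (length ps))))
    edge-closing (next [])       (_ ∷ e ∷ _) = e
    edge-closing (next (next I)) L           = edge-closing (next I) (Linked.tail (Linked.tail L))

  interleaving-cycle : ∀ {x₀ y₀ p ps vs} → Interleaving vs ((x₀ , y₀) ∷ p ∷ ps) →
                       Linked A (vs ++ inj₁ x₀ ∷ []) → Unique vs → Cycle E (length ps)
  interleaving-cycle {x₀} {y₀} {p} {ps} I L u = record
    { xs     = λ i → proj₁ (lookup ((x₀ , y₀) ∷ p ∷ ps) i)
    ; ys     = λ i → proj₂ (lookup ((x₀ , y₀) ∷ p ∷ ps) i)
    ; xs-inj = λ {i} {j} eq → endpoint-injective true  I u i j (cong inj₁ eq)
    ; ys-inj = λ {i} {j} eq → endpoint-injective false I u i j (cong inj₂ eq)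
    ; edge₁  = edges-along I L
    ; edge₂  = edges-back I L
    ; close  = edge-closing I L
    }

  module Acyclicity (acyclic : Acyclic E) where

    closed-chain-at-X : ∀ x l → Linked A (inj₁ x ∷ l ++ inj₁ x ∷ []) → Unique (inj₁ x ∷ l) →
                        2 ≤ length l → ⊥
    closed-chain-at-X x l L u long = from-interleaving (proj₂ (interleave x l L)) L u long
      where
      from-interleaving : ∀ {l ps} → Interleaving (inj₁ x ∷ l) ps →
                          Linked A (inj₁ x ∷ l ++ inj₁ x ∷ []) → Unique (inj₁ x ∷ l) →
                          2 ≤ length l → ⊥
      from-interleaving (next [])       _ _ (s≤s ())
      from-interleaving (next (next I)) L u _ = acyclic _ (interleaving-cycle (next (next I)) L u)

    -- Hence no closed chain v l v has distinct vertices v ∷ l, at least three of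
    -- them; one based at a Y-vertex is first rotated to start at an X-vertex.
    closed-chain : ∀ v l → Linked A (v ∷ l ++ v ∷ []) → Unique (v ∷ l) → 2 ≤ length l → ⊥
    closed-chain (inj₁ x) l                L        u long = closed-chain-at-X x l L u long
    closed-chain (inj₂ y) []               _        _ ()
    closed-chain (inj₂ y) (_ ∷ [])         _        _ (s≤s ())
    closed-chain (inj₂ y) (inj₂ _ ∷ _ ∷ _) (() ∷ _) _ _
    closed-chain (inj₂ y) (inj₁ x ∷ w ∷ l) L        u _ =
      closed-chain-at-X x (w ∷ l ++ inj₂ y ∷ []) (rotate-linked (w ∷ l) L) (rotate-unique (w ∷ l) u)
                        (s≤s (length-++-≤ʳ (inj₂ y ∷ []) {l}))

    close-up : ∀ Q₁ {a b r R Q₂} →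
               Linked A (b ∷ Q₁ ++ a ∷ Q₂) → Unique (b ∷ Q₁ ++ a ∷ Q₂) →
               Linked A (a ∷ r ∷ R ++ b ∷ []) → Unique (a ∷ r ∷ R) →
               Disjoint (r ∷ R) (b ∷ Q₁ ++ a ∷ Q₂) → ⊥
    close-up Q₁ {a} {b} {r} {R} Lq uq La ua disjoint =
      closed-chain b (Q₁ ++ a ∷ r ∷ R) cycle-linked cycle-unique cycle-long
      where
      cycle-linked : Linked A (b ∷ (Q₁ ++ a ∷ r ∷ R) ++ b ∷ [])
      cycle-linked = subst (λ zs → Linked A (b ∷ zs)) (sym (++-assoc Q₁ (a ∷ r ∷ R) (b ∷ [])))
                           (linked-join (b ∷ Q₁) (linked-prefix (b ∷ Q₁) Lq) La)

      separate : Disjoint (b ∷ Q₁) (a ∷ r ∷ R)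
      separate (a∈Q , here refl) = unique-++-∉ (b ∷ Q₁) uq a∈Q
      separate (v∈Q , there v∈R) = disjoint (v∈R , ∈-++⁺ˡ v∈Q)

      cycle-unique : Unique (b ∷ Q₁ ++ a ∷ r ∷ R)
      cycle-unique = ++⁺ (unique-prefix (b ∷ Q₁) uq) ua separate

      cycle-long : 2 ≤ length (Q₁ ++ a ∷ r ∷ R)
      cycle-long = ≤-trans (s≤s (s≤s z≤n)) (length-++-≤ʳ (a ∷ r ∷ R) {Q₁})

    -- If a lies on the simple walk q from b, then q and a chain a r R b through
    -- vertices off q close up into a cycle, unless the chain is a mere
    -- back-and-forth a r a (the case a ≡ b, R ≡ [] excluded by the last argument).
    reach : ∀ {a b t} (r : V) (R : List V) (q : Walk b t) → a ∈ verts q → Simple q →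
            Linked A (a ∷ r ∷ R ++ b ∷ []) → Unique (a ∷ r ∷ R) → Disjoint (r ∷ R) (verts q) →
            a ≢ b ⊎ R ≢ [] → ⊥
    reach {a} r R q (here refl) _ L u _ nondegenerate = closed-chain a (r ∷ R) L u (long nondegenerate)
      where
      long : ∀ {R} → a ≢ a ⊎ R ≢ [] → 2 ≤ length (r ∷ R)
      long         (inj₁ a≢a)  = ⊥-elim (a≢a refl)
      long {[]}    (inj₂ R≢[]) = ⊥-elim (R≢[] refl)
      long {_ ∷ _} (inj₂ _)    = s≤s (s≤s z≤n)
    reach r R q (there a∈q) sq L u dq _ with ∈-∃++ a∈q
    ... | Q₁ , Q₂ , eq =
      close-up Q₁ (subst (Linked A) eq′ (verts-linked q)) (subst Unique eq′ sq) L u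
               (λ {v} (v∈R , v∈Q) → dq (v∈R , subst (v ∈_) (sym eq′) v∈Q))
      where eq′ = cong (_ ∷_) eq

    -- Walk along the simple walk p until it first meets q (at the latest at
    -- the common end t), recording the vertices passed in reverse as r ∷ R.
    meet : ∀ {a b t} (r : V) (R : List V) (p : Walk a t) (q : Walk b t) →
           Simple p → Simple q → Linked A (a ∷ r ∷ R ++ b ∷ []) → Unique (a ∷ r ∷ R) →
           Disjoint (r ∷ R) (verts p) → Disjoint (r ∷ R) (verts q) → a ≢ b ⊎ R ≢ [] → ⊥
    meet r R stay q _ sq L u _ dq nondegenerate = reach r R q (last∈ q) sq L u dq nondegenerate
    meet {a} r R (e ◅ p) q sp sq L u dp dq nondegenerate with a ∈? verts q
    ... | yes a∈q = reach r R q a∈q sq L u dq nondegenerate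
    ... | no  a∉q =
      meet a (r ∷ R) p q (tail sp) sq (A-sym e ∷ L) (unique-∷ c∉ u) dp′ dq′ (inj₂ λ ())
      where
      tail : ∀ {v vs} → Unique (v ∷ vs) → Unique vs
      tail (_ ∷ u) = u
      c∉ : _ ∉ a ∷ r ∷ R
      c∉ (here c≡a)  = A-irrefl e (sym c≡a)
      c∉ (there c∈R) = dp (c∈R , there (here refl))
      dp′ : Disjoint (a ∷ r ∷ R) (verts p)
      dp′ (here refl , a∈p) = Unique[x∷xs]⇒x∉xs sp a∈p
      dp′ (there v∈R , v∈p) = dp (v∈R , there v∈p)
      dq′ : Disjoint (a ∷ r ∷ R) (verts q)
      dq′ (here refl , a∈q) = a∉q a∈q
      dq′ (there v∈R , v∈q) = dq (v∈R , v∈q)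

    -- Two simple walks from u to t agree; if their second vertices differ, 'meet' finds a cycle.
    simple-walks-agree : ∀ {u t} (p q : Walk u t) → Simple p → Simple q → verts p ≡ verts q
    simple-walks-agree stay    stay    _  _  = refl
    simple-walks-agree stay    (_ ◅ q) _  sq = ⊥-elim (Unique[x∷xs]⇒x∉xs sq (last∈ q))
    simple-walks-agree (_ ◅ p) stay    sp _  = ⊥-elim (Unique[x∷xs]⇒x∉xs sp (last∈ p))
    simple-walks-agree {u} (_◅_ {j = a} ea p) (_◅_ {j = b} eb q) sp@(_ ∷ sp′) sq@(_ ∷ sq′) with a ≟ b
    ... | yes refl = cong (u ∷_) (simple-walks-agree p q sp′ sq′)
    ... | no  a≢b  = ⊥-elim $ meet u [] p q sp′ sq′ (A-sym ea ∷ eb ∷ [-]) au-unique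
                                (λ { (here refl , u∈p) → Unique[x∷xs]⇒x∉xs sp u∈p })
                                (λ { (here refl , u∈q) → Unique[x∷xs]⇒x∉xs sq u∈q })
                                (inj₁ a≢b)
      where
      au-unique : Unique (a ∷ u ∷ [])
      au-unique = unique-∷ (λ { (here a≡u) → A-irrefl ea (sym a≡u) }) ([] ∷ [])

record Separation {m n : ℕ} (E : BipGraph m n) (x₀ : Fin m) (y₀ : Fin n) : Set where
  field
    inside     : Vertex m n → Bool
    x₀-inside  : inside (inj₁ x₀) ≡ true
    y₀-outside : inside (inj₂ y₀) ≡ false
    leaving    : ∀ {x y} → IsEdge E x y → inside (inj₁ x) ≡ true → inside (inj₂ y) ≡ false →
                 x ≡ x₀ × y ≡ y₀
    entering   : ∀ {x y} → IsEdge E x y → inside (inj₁ x) ≡ false → inside (inj₂ y) ≡ true → ⊥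

-- Every edge of a tree is separated by the set of vertices whose path to y₀
-- passes through x₀.
module TreeSeparation {m n : ℕ} {E : BipGraph m n} (tree : IsTree E)
                      {x₀ : Fin m} {y₀ : Fin n} (e₀ : IsEdge E x₀ y₀) where
  open Walks E
  open Acyclicity (proj₂ tree)
  open import Data.List.Membership.DecPropositional _≟_ using (_∈?_)

  root : V
  root = inj₂ y₀

  path : (v : V) → Walk v root
  path v = proj₁ (loop-erase (proj₁ tree v root))

  path-simple : (v : V) → Simple (path v)
  path-simple v = proj₂ (loop-erase (proj₁ tree v root))

  path-unique : ∀ {v} (w : Walk v root) → Simple w → verts w ≡ verts (path v)
  path-unique {v} w sw = simple-walks-agree w (path v) sw (path-simple v)

  neighbour-path : ∀ {u v} → A u v →
                   verts (path u) ⊆ verts (path v) ⊎ verts (path u) ≡ u ∷ verts (path v)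
  neighbour-path {u} {v} e with u ∈? verts (path v)
  ... | yes u∈ = inj₁ λ {z} z∈ → suffix-⊆ (path v) u∈ (subst (z ∈_) path-is-suffix z∈)
    where
    path-is-suffix : verts (path u) ≡ verts (suffix (path v) u∈)
    path-is-suffix = sym (path-unique (suffix (path v) u∈) (suffix-simple (path v) u∈ (path-simple v)))
  ... | no  u∉ = inj₂ (sym (path-unique (e ◅ path v) (unique-∷ u∉ (path-simple v))))

  inside : V → Bool
  inside v = does (inj₁ x₀ ∈? verts (path v))

  on-path : ∀ {v} → inside v ≡ true → inj₁ x₀ ∈ verts (path v)
  on-path {v} = decided-yes (inj₁ x₀ ∈? verts (path v))

  off-path : ∀ {v} → inside v ≡ false → inj₁ x₀ ∉ verts (path v)
  off-path {v} = decided-no (inj₁ x₀ ∈? verts (path v))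

  -- An edge (x,y) with x inside and y outside must be (x₀,y₀): the path from x
  -- is x followed by the path from y, so x = x₀, and then y is the next vertex
  -- after x₀ on its path, which is y₀.
  leaving : ∀ {x y} → IsEdge E x y → inside (inj₁ x) ≡ true → inside (inj₂ y) ≡ false →
            x ≡ x₀ × y ≡ y₀
  leaving {x} {y} e x-in y-out with neighbour-path {inj₁ x} {inj₂ y} e
  ... | inj₁ ⊆ = ⊥-elim (off-path y-out (⊆ (on-path x-in)))
  ... | inj₂ eq with subst (inj₁ x₀ ∈_) eq (on-path x-in)
  ...   | there x₀∈ = ⊥-elim (off-path y-out x₀∈)
  ...   | here refl = refl , sym y₀≡y
    where
    simple-edge : Simple (e₀ ◅ stay)
    simple-edge = unique-∷ (λ { (here ()) }) ([] ∷ [])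
    y₀≡y : y₀ ≡ y
    y₀≡y = inj₂-injective (∷-injectiveˡ (∷-injectiveʳ (trans (path-unique (e₀ ◅ stay) simple-edge) eq)))

  -- No edge (x,y) has x outside and y inside: the path from y contains x₀ and is
  -- either contained in the path from x or is y followed by it, so x₀ would lie
  -- on the path from x.
  entering : ∀ {x y} → IsEdge E x y → inside (inj₁ x) ≡ false → inside (inj₂ y) ≡ true → ⊥
  entering {x} {y} e x-out y-in with neighbour-path {inj₂ y} {inj₁ x} e
  ... | inj₁ ⊆ = off-path x-out (⊆ (on-path y-in))
  ... | inj₂ eq with subst (inj₁ x₀ ∈_) eq (on-path y-in)
  ...   | there x₀∈ = off-path x-out x₀∈

  separation : Separation E x₀ y₀
  separation = record
    { inside     = inside
    ; x₀-inside  = dec-true (inj₁ x₀ ∈? verts (path (inj₁ x₀))) (here refl)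
    ; y₀-outside = dec-false (inj₁ x₀ ∈? verts (path root))
                     (λ x₀∈ → x₀∉root (subst (inj₁ x₀ ∈_) (sym root-path) x₀∈))
    ; leaving    = leaving
    ; entering   = entering
    }
    where
    root-path : verts (stay {x = root}) ≡ verts (path root)
    root-path = path-unique stay ([] ∷ [])
    x₀∉root : inj₁ x₀ ∉ root ∷ []
    x₀∉root (here ())

module FiniteSums {c ℓ : Level} (G : AbelianGroup c ℓ) where
  open AbelianGroup G renaming (refl to ≈-refl; sym to ≈-sym; trans to ≈-trans)
  open import Algebra.Properties.CommutativeMonoid.Sum commutativeMonoid
    using (sum; sum-cong-≋; sum-replicate-zero)

  when : Bool → Carrier → Carrier
  when b a = if b then a else ε

  when-cong : ∀ b {a a′} → a ≈ a′ → when b a ≈ when b a′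
  when-cong true  a≈a′ = a≈a′
  when-cong false _    = ≈-refl

  when-sum : ∀ {k} b (f : Fin k → Carrier) → when b (sum f) ≈ sum (λ i → when b (f i))
  when-sum     true  f = ≈-refl
  when-sum {k} false f = ≈-sym (sum-replicate-zero k)

  sum-zero : ∀ {k} {f : Fin k → Carrier} → (∀ i → f i ≈ ε) → sum f ≈ ε
  sum-zero {k} f≈ε = ≈-trans (sum-cong-≋ f≈ε) (sum-replicate-zero k)

  sum-single : ∀ {k} {f : Fin k → Carrier} (i₀ : Fin k) → (∀ i → i ≢ i₀ → f i ≈ ε) →
               sum f ≈ f i₀
  sum-single zero    away = ≈-trans (∙-congˡ (sum-zero (λ i → away (suc i) λ ()))) (identityʳ _)
  sum-single (suc j) away =
    ≈-trans (∙-congʳ (away zero λ ())) (≈-trans (identityˡ _)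
      (sum-single j (λ i i≢j → away (suc i) (λ { refl → i≢j refl }))))

module CutBalance {c ℓ : Level} (G : AbelianGroup c ℓ) {m n : ℕ} (E : BipGraph m n)
                  (gE : Fin m → Fin n → AbelianGroup.Carrier G)
                  {x₀ : Fin m} {y₀ : Fin n} (e₀ : IsEdge E x₀ y₀) (S : Separation E x₀ y₀) where
  open AbelianGroup G renaming (refl to ≈-refl; sym to ≈-sym; trans to ≈-trans)
  open FiniteSums G
  open Separation S
  open import Algebra.Properties.CommutativeMonoid.Sum commutativeMonoid
    using (sum; ∑-distrib-+; ∑-comm; sum-cong-≋)
  open import Relation.Binary.Reasoning.Setoid setoid

  flow : Fin m → Fin n → Carrier
  flow x y = when (E x y) (gE x y)

  toInside : Fin m → Fin n → Carrier
  toInside x y = when (inside (inj₂ y)) (flow x y)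

  crossing : Fin m → Fin n → Carrier
  crossing x y = when (inside (inj₁ x) ∧ not (inside (inj₂ y))) (flow x y)

  -- Each edge at an inside X-vertex either ends inside S or crosses the cut;
  -- edges from outside into S do not exist.
  split : ∀ x y → when (inside (inj₁ x)) (flow x y) ≈ toInside x y ∙ crossing x y
  split x y with inside (inj₁ x) in sx | inside (inj₂ y) in sy
  ... | true  | true  = ≈-sym (identityʳ _)
  ... | true  | false = ≈-sym (identityˡ _)
  ... | false | false = ≈-sym (identityˡ _)
  ... | false | true with E x y in exy
  ...   | true  = ⊥-elim (entering exy sx sy)
  ...   | false = ≈-sym (identityˡ _)

  crossing-away : ∀ x y → ¬ (x ≡ x₀ × y ≡ y₀) → crossing x y ≈ ε
  crossing-away x y ≢e₀ with inside (inj₁ x) in sx | inside (inj₂ y) in sy | E x y in exy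
  ... | true  | false | true  = ⊥-elim (≢e₀ (leaving exy sx sy))
  ... | true  | false | false = ≈-refl
  ... | true  | true  | _     = ≈-refl
  ... | false | _     | _     = ≈-refl

  crossing-at : crossing x₀ y₀ ≈ gE x₀ y₀
  crossing-at rewrite x₀-inside | y₀-outside | e₀ = ≈-refl

  crossing-total : sum (λ x → sum (λ y → crossing x y)) ≈ gE x₀ y₀
  crossing-total = begin
    sum (λ x → sum (crossing x))
      ≈⟨ sum-single x₀ (λ x x≢x₀ → sum-zero (λ y → crossing-away x y (x≢x₀ ∘′ proj₁))) ⟩
    sum (crossing x₀)
      ≈⟨ sum-single y₀ (λ y y≢y₀ → crossing-away x₀ y (y≢y₀ ∘′ proj₂)) ⟩
    crossing x₀ y₀
      ≈⟨ crossing-at ⟩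
    gE x₀ y₀ ∎

  balance : sum (λ x → when (inside (inj₁ x)) (sumYx G E gE x))
            ≈ sum (λ y → when (inside (inj₂ y)) (sumXy G E gE y)) ∙ gE x₀ y₀
  balance = begin
    sum (λ x → when (inside (inj₁ x)) (sum (flow x)))
      ≈⟨ sum-cong-≋ (λ x → when-sum (inside (inj₁ x)) (flow x)) ⟩
    sum (λ x → sum (λ y → when (inside (inj₁ x)) (flow x y)))
      ≈⟨ sum-cong-≋ (λ x → ≈-trans (sum-cong-≋ (split x))
                                    (∑-distrib-+ (toInside x) (crossing x))) ⟩
    sum (λ x → sum (toInside x) ∙ sum (crossing x))
      ≈⟨ ∑-distrib-+ (λ x → sum (toInside x)) (λ x → sum (crossing x)) ⟩
    sum (λ x → sum (toInside x)) ∙ sum (λ x → sum (crossing x))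
      ≈⟨ ∙-cong (∑-comm toInside) crossing-total ⟩
    sum (λ y → sum (λ x → toInside x y)) ∙ gE x₀ y₀
      ≈⟨ ∙-congʳ (sum-cong-≋ (λ y → ≈-sym (when-sum (inside (inj₂ y)) (λ x → flow x y)))) ⟩
    sum (λ y → when (inside (inj₂ y)) (sum (λ x → flow x y))) ∙ gE x₀ y₀ ∎

module SubgroupFacts {c ℓ p : Level} (G : AbelianGroup c ℓ) {H : AbelianGroup.Carrier G → Set p}
                     (sub : IsSubgroup G H) where
  open AbelianGroup G renaming (sym to ≈-sym)
  open FiniteSums G
  open IsSubgroup sub
  open import Algebra.Properties.CommutativeMonoid.Sum commutativeMonoid using (sum)
  open import Algebra.Properties.Group group using (y≈x\\z)

  when-∈ : ∀ b {a} → H a → H (when b a)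
  when-∈ true  ha = ha
  when-∈ false _  = has-ε

  sum-∈ : ∀ {k} {f : Fin k → Carrier} → (∀ i → H (f i)) → H (sum f)
  sum-∈ {ℕ.zero}  _  = has-ε
  sum-∈ {ℕ.suc k} hf = closed (hf zero) (sum-∈ (λ i → hf (suc i)))

  cancel-∈ : ∀ {a b c} → H a → H b → a ≈ b ∙ c → H c
  cancel-∈ {a} {b} {c} ha hb a≈b∙c = resp (≈-sym (y≈x\\z b c a (≈-sym a≈b∙c))) (closed (inv hb) ha)

lemma3p2 : {c ℓ p : Level} (m n : ℕ) → 2 ≤ m → 2 ≤ n →
    (E : BipGraph m n) → IsTree E →
    (G : AbelianGroup c ℓ) (H : AbelianGroup.Carrier G → Set p) → IsSubgroup G H →
    (gX : Fin m → AbelianGroup.Carrier G) (gY : Fin n → AbelianGroup.Carrier G)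
    (gE : Fin m → Fin n → AbelianGroup.Carrier G) →
    (∀ x → H (gX x)) → (∀ y → H (gY y)) →
    (∀ x → AbelianGroup._≈_ G (gX x) (sumYx G E gE x)) →
    (∀ y → AbelianGroup._≈_ G (gY y) (sumXy G E gE y)) →
    ∀ x y → IsEdge E x y → H (gE x y)
lemma3p2 m n _ _ E tree G H sub gX gY gE hX hY eX eY x y e =
  cancel-∈ (sum-∈ (λ a → when-∈ _ (hX a))) (sum-∈ (λ b → when-∈ _ (hY b))) vertex-balance
  where
  open AbelianGroup G using (_≈_; _∙_; ∙-congʳ; commutativeMonoid)
    renaming (sym to ≈-sym; trans to ≈-trans)
  open FiniteSums G
  open SubgroupFacts G sub
  open import Algebra.Properties.CommutativeMonoid.Sum commutativeMonoid using (sum; sum-cong-≋)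
  open Separation (TreeSeparation.separation tree e)
  open CutBalance G E gE e (TreeSeparation.separation tree e) using (balance)

  vertex-balance : sum (λ a → when (inside (inj₁ a)) (gX a))
                   ≈ sum (λ b → when (inside (inj₂ b)) (gY b)) ∙ gE x y
  vertex-balance =
    ≈-trans (sum-cong-≋ (λ a → when-cong (inside (inj₁ a)) (eX a)))
      (≈-trans balance (∙-congʳ (≈-sym (sum-cong-≋ (λ b → when-cong (inside (inj₂ b)) (eY b))))))
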